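{- Let $G$ be a tree in which every node has degree at most three, with $|G| \geq 3$ nodes. Then there exists an edge $e$ of $G$ such that deleting $e$ yields component trees $G_0, G_1$ with $|G_0| \in \{2,3\}$.
   Context: $|G|$ denotes the number of nodes of $G$. -}

module Defs where

open import Data.Nat using (ℕ; _≤_)
open import Data.Bool using (Bool; true; false; _∧_; _∨_; not)
open import Data.Fin using (Fin; _≟_)
open import Data.Fin.Subset using (Subset; _∈_; ∣_∣)
open import Data.Vec using (tabulate)
open import Data.List using (List; []; _∷_; length; _∷ʳ_)
open import Data.List.Relation.Unary.Linked using (Linked)
open import Data.List.Relation.Unary.Unique.Propositional using (Unique)
open import Data.Product using (Σ; _×_; ∃)
open import Relation.Binary.PropositionalEquality using (_≡_)
open import Relation.Nullary using (¬_; ⌊_⌋)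
open import Function.Bundles using (_⇔_)

record Graph (n : ℕ) : Set where
  field
    adj   : Fin n → Fin n → Bool
    sym   : ∀ x y → adj x y ≡ adj y x
    irrefl : ∀ x → adj x x ≡ false
open Graph public

Adj : ∀ {n} → Graph n → Fin n → Fin n → Set
Adj G x y = adj G x y ≡ true

nbhd : ∀ {n} → Graph n → Fin n → Subset n
nbhd G x = tabulate (adj G x)

degree : ∀ {n} → Graph n → Fin n → ℕ
degree G x = ∣ nbhd G x ∣

data Walk {n} (G : Graph n) : Fin n → Fin n → Set where
  here : ∀ {x} → Walk G x x
  step : ∀ {x y z} → Adj G x y → Walk G y z → Walk G x z

Connected : ∀ {n} → Graph n → Set
Connected G = ∀ x y → Walk G x y

HasCycle : ∀ {n} → Graph n → Set
HasCycle {n} G = Σ (Fin n) λ x → Σ (List (Fin n)) λ vs →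
  (2 ≤ length vs) × Unique (x ∷ vs) × Linked (Adj G) ((x ∷ vs) ∷ʳ x)

IsTree : ∀ {n} → Graph n → Set
IsTree G = Connected G × ¬ HasCycle G

deleteEdge : ∀ {n} → Graph n → Fin n → Fin n → Graph n
deleteEdge G u v = record
  { adj = λ x y → adj G x y ∧ not ((⌊ x ≟ u ⌋ ∧ ⌊ y ≟ v ⌋) ∨ (⌊ x ≟ v ⌋ ∧ ⌊ y ≟ u ⌋))
  ; sym = λ x y → symLemma x y
  ; irrefl = λ x → irr x }
  where
  open import Data.Bool.Properties using (∧-comm; ∨-comm)
  open import Relation.Binary.PropositionalEquality using (cong₂; cong; trans; refl)
  symLemma : ∀ x y → (adj G x y ∧ not ((⌊ x ≟ u ⌋ ∧ ⌊ y ≟ v ⌋) ∨ (⌊ x ≟ v ⌋ ∧ ⌊ y ≟ u ⌋)))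
                    ≡ (adj G y x ∧ not ((⌊ y ≟ u ⌋ ∧ ⌊ x ≟ v ⌋) ∨ (⌊ y ≟ v ⌋ ∧ ⌊ x ≟ u ⌋)))
  symLemma x y = cong₂ _∧_ (Graph.sym G x y)
    (cong not (trans (∨-comm (⌊ x ≟ u ⌋ ∧ ⌊ y ≟ v ⌋) (⌊ x ≟ v ⌋ ∧ ⌊ y ≟ u ⌋))
      (cong₂ _∨_ (∧-comm ⌊ x ≟ v ⌋ ⌊ y ≟ u ⌋) (∧-comm ⌊ x ≟ u ⌋ ⌊ y ≟ v ⌋))))
  irr : ∀ x → (adj G x x ∧ _) ≡ false
  irr x rewrite Graph.irrefl G x = refl

IsComponentOf : ∀ {n} → Graph n → Fin n → Subset n → Set
IsComponentOf {n} H u S = ∀ (x : Fin n) → (x ∈ S) ⇔ Walk H u x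

-- Grow a path a ∷ b ∷ … at its end a for as long as a has a neighbour d ≠ b which is
-- not a leaf. Acyclicity keeps the path free of repetitions, so this stops within n steps.
-- At the final end a every neighbour other than b is a leaf and there is at least one of
-- them, so deleting the edge ab cuts off the star of a without b: a component with
-- deg a ∈ {2, 3} vertices.
module Submission where

open import Defs hiding (sym)
open import Level using (0ℓ)
open import Data.Nat using (ℕ; _≤_; _<_; zero; suc; _+_; z≤n; s≤s)
open import Data.Nat.Properties using (<-irrefl; ≤-trans; n≤1+n; +-suc; +-identityʳ)
open import Data.Fin using (Fin; zero; suc; _≟_; punchIn; punchOut)
open import Data.Fin.Properties using (any?; injective⇒≤; suc-injective; punchInᵢ≢i; punchIn-injective; punchIn-punchOut)
open import Data.Fin.Subset using (Subset; ∣_∣; _∈_)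
open import Data.Fin.Subset.Properties using (x∈p⇒∣p-x∣<∣p∣)
open import Data.Product using (Σ; ∃; ∃₂; _×_; _,_; proj₁)
open import Data.Sum using (_⊎_; inj₁; inj₂; [_,_])
open import Data.Bool using (true; false)
open import Data.Bool.Properties using (∧-zeroʳ)
open import Data.Vec using (tabulate; _∷_)
open import Data.Vec.Properties using (lookup∘tabulate; lookup⇒[]=; []=⇒lookup; tabulate-cong)
open import Data.List using (List; []; _∷_; length; _∷ʳ_; lookup)
open import Data.List.Relation.Unary.Linked using (Linked; [-]; _∷_)
open import Data.List.Relation.Unary.AllPairs using (AllPairs; []; _∷_)
open import Data.List.Relation.Unary.All using (All; []; _∷_)
import Data.List.Relation.Unary.All as All
open import Data.List.Relation.Unary.All.Properties using (¬Any⇒All¬)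
open import Data.List.Relation.Unary.Any using (here; there)
open import Data.List.Relation.Unary.Unique.Propositional using (Unique)
open import Data.List.Membership.Propositional using () renaming (_∈_ to _∈ₗ_; _∉_ to _∉ₗ_)
open import Data.List.Membership.Propositional.Properties using (∈-lookup)
open import Relation.Binary.PropositionalEquality using (_≡_; _≢_; refl; sym; trans; cong; subst)
open import Relation.Nullary using (¬_; Dec; yes; no; does; ⌊_⌋; _×-dec_; _⊎-dec_; ¬?; contradiction)
open import Relation.Nullary.Reflects using (Reflects; ofʸ; ofⁿ)
open import Relation.Nullary.Decidable using (isYes≗does; dec-true; dec-false; does-⇔; decidable-stable)
open import Relation.Unary using (Pred; Decidable)
open import Function.Base using (_∘_; id)
open import Function.Bundles using (_⇔_; mk⇔)

subsetOf : ∀ {n} {P : Pred (Fin n) 0ℓ} → Decidable P → Subset n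
subsetOf P? = tabulate (λ x → does (P? x))

∈-subsetOf⁺ : ∀ {n} {P : Pred (Fin n) 0ℓ} (P? : Decidable P) {x} → P x → x ∈ subsetOf P?
∈-subsetOf⁺ P? {x} px = lookup⇒[]= x _ (trans (lookup∘tabulate _ x) (dec-true (P? x) px))

∈-subsetOf⁻ : ∀ {n} {P : Pred (Fin n) 0ℓ} (P? : Decidable P) {x} → x ∈ subsetOf P? → P x
∈-subsetOf⁻ P? {x} x∈ with P? x | trans (sym (lookup∘tabulate _ x)) ([]=⇒lookup x∈)
... | yes px | _ = px

∣subsetOf∣-extend : ∀ {n} {P Q : Pred (Fin n) 0ℓ} (P? : Decidable P) (Q? : Decidable Q) {x : Fin n} →
                    P x → ¬ Q x → (∀ {y} → y ≢ x → P y ⇔ Q y) →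
                    ∣ subsetOf P? ∣ ≡ suc ∣ subsetOf Q? ∣
∣subsetOf∣-extend {n = suc n} P? Q? {zero} px ¬qx agree
  rewrite dec-true (P? zero) px | dec-false (Q? zero) ¬qx
  = cong (λ s → suc ∣ s ∣) (tabulate-cong λ y → does-⇔ (agree λ ()) (P? (suc y)) (Q? (suc y)))
∣subsetOf∣-extend {n = suc n} P? Q? {suc x} px ¬qx agree
  rewrite does-⇔ (agree λ ()) (P? zero) (Q? zero)
  = ∣∷∣-suc (does (Q? zero)) (subsetOf (P? ∘ suc)) (subsetOf (Q? ∘ suc))
      (∣subsetOf∣-extend (P? ∘ suc) (Q? ∘ suc) px ¬qx λ y≢x → agree (y≢x ∘ suc-injective))
  where
  ∣∷∣-suc : ∀ {m} b (p q : Subset m) → ∣ p ∣ ≡ suc ∣ q ∣ → ∣ b ∷ p ∣ ≡ suc ∣ b ∷ q ∣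
  ∣∷∣-suc true  _ _ eq = cong suc eq
  ∣∷∣-suc false _ _ eq = eq

isYes-≟-refl : ∀ {n} (x : Fin n) → ⌊ x ≟ x ⌋ ≡ true
isYes-≟-refl x = trans (isYes≗does (x ≟ x)) (dec-true (x ≟ x) refl)

isYes-≟-≢ : ∀ {n} {x y : Fin n} → x ≢ y → ⌊ x ≟ y ⌋ ≡ false
isYes-≟-≢ {x = x} {y} x≢y = trans (isYes≗does (x ≟ y)) (dec-false (x ≟ y) x≢y)

≡true-reflects : ∀ b → Reflects (b ≡ true) b
≡true-reflects true  = ofʸ refl
≡true-reflects false = ofⁿ λ ()

module _ {n : ℕ} (G : Graph n) where

  -- Deciding with does = adj G x y makes nbhd G x and subsetOf (Adj? G x) definitionally equal.
  Adj? : ∀ x y → Dec (Adj G x y)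
  Adj? x y = record { does = adj G x y ; proof = ≡true-reflects (adj G x y) }

  Adj-sym : ∀ {x y} → Adj G x y → Adj G y x
  Adj-sym {x} {y} xy = trans (Graph.sym G y x) xy

  Adj-irrefl : ∀ {x y} → Adj G x y → x ≢ y
  Adj-irrefl {x} xx refl with () ← trans (sym xx) (Graph.irrefl G x)

  deleteEdge-⊆ : ∀ {u v x y} → Adj (deleteEdge G u v) x y → Adj G x y
  deleteEdge-⊆ {x = x} {y} xy with adj G x y
  ... | true = refl

  deleteEdge-removes : ∀ {u v} → ¬ Adj (deleteEdge G u v) u v
  deleteEdge-removes {u} {v} uv
    rewrite isYes-≟-refl u | isYes-≟-refl v | ∧-zeroʳ (adj G u v)
    with () ← uv

  deleteEdge-keeps : ∀ {u v x y} → Adj G x y → x ≢ v → y ≢ v → Adj (deleteEdge G u v) x y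
  deleteEdge-keeps {u} {v} {x} {y} xy x≢v y≢v
    rewrite isYes-≟-≢ x≢v | isYes-≟-≢ y≢v | ∧-zeroʳ ⌊ x ≟ u ⌋ | xy = refl

  walk-exits : ∀ {P : Pred (Fin n) 0ℓ} → Decidable P → ∀ {x y} → Walk G x y → P x → ¬ P y →
               ∃₂ λ s t → P s × ¬ P t × Adj G s t
  walk-exits P? here px ¬py = contradiction px ¬py
  walk-exits P? (step {y = z} xz w) px ¬py with P? z
  ... | yes pz = walk-exits P? w pz ¬py
  ... | no ¬pz = _ , z , px , ¬pz , xz

  walk-closed : ∀ {P : Pred (Fin n) 0ℓ} → (∀ {x y} → P x → Adj G x y → P y) →
                ∀ {x y} → Walk G x y → P x → P y
  walk-closed closed here px = px
  walk-closed closed (step xz w) px = walk-closed closed w (closed px xz)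

  component-intro : ∀ {u} (S : Subset n) → u ∈ S → (∀ {x y} → x ∈ S → Adj G x y → y ∈ S) →
                    (∀ {x} → x ∈ S → Walk G u x) → IsComponentOf G u S
  component-intro S u∈S closed reach x = mk⇔ reach (λ w → walk-closed closed w u∈S)

Unique-lookup-injective : ∀ {n} {xs : List (Fin n)} → Unique xs →
                          ∀ {i j} → lookup xs i ≡ lookup xs j → i ≡ j
Unique-lookup-injective (_ ∷ _) {zero} {zero} _ = refl
Unique-lookup-injective (x∉ ∷ _) {zero} {suc j} eq = contradiction eq (All.lookup x∉ (∈-lookup j))
Unique-lookup-injective (x∉ ∷ _) {suc i} {zero} eq = contradiction (sym eq) (All.lookup x∉ (∈-lookup i))
Unique-lookup-injective (_ ∷ u) {suc i} {suc j} eq = cong suc (Unique-lookup-injective u eq)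

Unique⇒length≤ : ∀ {n} {xs : List (Fin n)} → Unique xs → length xs ≤ n
Unique⇒length≤ u = injective⇒≤ (Unique-lookup-injective u)

module _ {A : Set} where

  takeThrough : ∀ {d : A} {xs} → d ∈ₗ xs → List A
  takeThrough (here {x = x} _)  = x ∷ []
  takeThrough (there {x = x} p) = x ∷ takeThrough p

  takeThrough-All : ∀ {P : Pred A 0ℓ} {d xs} (p : d ∈ₗ xs) → All P xs → All P (takeThrough p)
  takeThrough-All (here _)  (px ∷ _)   = px ∷ []
  takeThrough-All (there p) (px ∷ pxs) = px ∷ takeThrough-All p pxs

  takeThrough-AllPairs : ∀ {R : A → A → Set} {d xs} (p : d ∈ₗ xs) → AllPairs R xs → AllPairs R (takeThrough p)
  takeThrough-AllPairs (here _)  (_ ∷ _)    = [] ∷ []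
  takeThrough-AllPairs (there p) (rs ∷ rss) = takeThrough-All p rs ∷ takeThrough-AllPairs p rss

  takeThrough-Linked : ∀ {R : A → A → Set} {d x y xs} (p : d ∈ₗ xs) → Linked R (x ∷ xs) → R d y →
                       Linked R (x ∷ takeThrough p ∷ʳ y)
  takeThrough-Linked (here refl) (r ∷ _) rdy = r ∷ rdy ∷ [-]
  takeThrough-Linked (there p)   (r ∷ rs) rdy = r ∷ takeThrough-Linked p rs rdy

  takeThrough-nonempty : ∀ {d : A} {xs} (p : d ∈ₗ xs) → 1 ≤ length (takeThrough p)
  takeThrough-nonempty (here _)  = s≤s z≤n
  takeThrough-nonempty (there _) = s≤s z≤n

distinct-from-two : ∀ {m} (x y : Fin (3 + m)) → ∃ λ z → z ≢ x × z ≢ y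
distinct-from-two x y with x ≟ y
... | yes refl = punchIn x zero , punchInᵢ≢i x zero , punchInᵢ≢i x zero
... | no x≢y = punchIn x (punchIn y′ zero) , punchInᵢ≢i x _ , λ z≡y →
      punchInᵢ≢i y′ zero (punchIn-injective x _ _ (trans z≡y (sym (punchIn-punchOut x≢y))))
  where y′ = punchOut x≢y

two-or-three : ∀ {k} → 1 ≤ k → suc k ≤ 3 → suc k ≡ 2 ⊎ suc k ≡ 3
two-or-three {1} _ _ = inj₁ refl
two-or-three {2} _ _ = inj₂ refl
two-or-three {suc (suc (suc _))} _ (s≤s (s≤s (s≤s ())))

OtherNeighbour : ∀ {n} → Graph n → Fin n → Fin n → Set
OtherNeighbour G a b = ∃ λ c → Adj G a c × c ≢ b

AllLeavesExcept : ∀ {n} → Graph n → Fin n → Fin n → Set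
AllLeavesExcept G a b = ∀ {d e} → Adj G a d → d ≢ b → Adj G d e → e ≡ a

module _ {n : ℕ} (G : Graph n) where

  allLeavesExcept? : ∀ a b → AllLeavesExcept G a b ⊎ ∃₂ λ d e → Adj G a d × d ≢ b × Adj G d e × e ≢ a
  allLeavesExcept? a b
    with any? (λ d → Adj? G a d ×-dec ¬? (d ≟ b) ×-dec any? (λ e → Adj? G d e ×-dec ¬? (e ≟ a)))
  ... | yes (d , ad , d≢b , e , de , e≢a) = inj₂ (d , e , ad , d≢b , de , e≢a)
  ... | no none = inj₁ λ {d} {e} ad d≢b de →
        decidable-stable (e ≟ a) λ e≢a → none (d , ad , d≢b , e , de , e≢a)

  -- A walk from 0 to a vertex outside {0, y} must leave {0, y} along a further edge at 0 or at y.
  branchingEdge : Connected G → 3 ≤ n → ∃₂ λ a b → Adj G a b × OtherNeighbour G a b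
  branchingEdge connected (s≤s (s≤s (s≤s _))) with distinct-from-two zero zero
  ... | w , w≢0 , _ with walk-exits G (_≟ zero) (connected zero w) refl w≢0
  ...   | .zero , y , refl , _ , 0y with distinct-from-two zero y
  ...     | z , z≢0 , z≢y with walk-exits G (λ v → v ≟ zero ⊎-dec v ≟ y) (connected zero z) (inj₁ refl)
                                 [ z≢0 , z≢y ]
  ...       | .zero , t , inj₁ refl , t∉ , 0t = zero , y , 0y , t , 0t , t∉ ∘ inj₂
  ...       | .y    , t , inj₂ refl , t∉ , yt = y , zero , Adj-sym G 0y , t , yt , t∉ ∘ inj₁

  module _ (acyclic : ¬ HasCycle G) where

    neighbour∉path : ∀ {a b d rest} → Unique (a ∷ b ∷ rest) → Linked (Adj G) (a ∷ b ∷ rest) →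
                     Adj G a d → d ∉ₗ rest
    neighbour∉path u l ad d∈rest = acyclic
      ( _ , _ ∷ takeThrough d∈rest , s≤s (takeThrough-nonempty d∈rest)
      , takeThrough-AllPairs (there (there d∈rest)) u , takeThrough-Linked (there d∈rest) l (Adj-sym G ad))

    extendPath : ∀ {a b d rest} → Unique (a ∷ b ∷ rest) → Linked (Adj G) (a ∷ b ∷ rest) →
                 Adj G a d → d ≢ b → Unique (d ∷ a ∷ b ∷ rest)
    extendPath {rest = rest} u l ad d≢b =
      ((λ d≡a → Adj-irrefl G ad (sym d≡a)) ∷ d≢b ∷ ¬Any⇒All¬ rest (neighbour∉path u l ad)) ∷ u

    pendantStarEdge-from : ∀ k {a b rest} → n < length (a ∷ b ∷ rest) + k →
                    Unique (a ∷ b ∷ rest) → Linked (Adj G) (a ∷ b ∷ rest) → OtherNeighbour G a b →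
                    ∃₂ λ a′ b′ → Adj G a′ b′ × OtherNeighbour G a′ b′ × AllLeavesExcept G a′ b′
    pendantStarEdge-from zero bound u _ _ =
      contradiction (≤-trans (subst (n <_) (+-identityʳ _) bound) (Unique⇒length≤ u)) (<-irrefl refl)
    pendantStarEdge-from (suc k) {a} {b} bound u l@(ab ∷ _) other with allLeavesExcept? a b
    ... | inj₁ leaves = a , b , ab , other , leaves
    ... | inj₂ (d , e , ad , d≢b , de , e≢a) =
      pendantStarEdge-from k (subst (n <_) (+-suc _ k) bound) (extendPath u l ad d≢b) (Adj-sym G ad ∷ l) (e , de , e≢a)

    pendantStarEdge : ∀ {a b} → Adj G a b → OtherNeighbour G a b →
               ∃₂ λ a′ b′ → Adj G a′ b′ × OtherNeighbour G a′ b′ × AllLeavesExcept G a′ b′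
    pendantStarEdge ab = pendantStarEdge-from n (s≤s (n≤1+n n)) ((Adj-irrefl G ab ∷ []) ∷ [] ∷ []) (ab ∷ [-])

  cutPendantStar : ∀ {a b} → Adj G a b → OtherNeighbour G a b → AllLeavesExcept G a b → degree G a ≤ 3 →
            Σ (Subset n) λ S → IsComponentOf (deleteEdge G a b) a S × (∣ S ∣ ≡ 2 ⊎ ∣ S ∣ ≡ 3)
  cutPendantStar {a} {b} ab (c , ac , c≢b) leaves deg≤3 = subsetOf Star? , component , size
    where
    H = deleteEdge G a b

    Beyond Star : Pred (Fin n) 0ℓ
    Beyond x = Adj G a x × x ≢ b
    Star x = x ≡ a ⊎ Beyond x

    Beyond? : Decidable Beyond
    Beyond? x = Adj? G a x ×-dec ¬? (x ≟ b)
    Star? : Decidable Star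
    Star? x = x ≟ a ⊎-dec Beyond? x

    star-closed : ∀ {x y} → Star x → Adj H x y → Star y
    star-closed (inj₁ refl)       xy = inj₂ (deleteEdge-⊆ G xy , λ { refl → deleteEdge-removes G xy })
    star-closed (inj₂ (ax , x≢b)) xy = inj₁ (leaves ax x≢b (deleteEdge-⊆ G xy))

    star-reachable : ∀ {x} → Star x → Walk H a x
    star-reachable (inj₁ refl)       = here
    star-reachable (inj₂ (ax , x≢b)) = step (deleteEdge-keeps G ax (Adj-irrefl G ab) x≢b) here

    component : IsComponentOf H a (subsetOf Star?)
    component = component-intro H (subsetOf Star?) (∈-subsetOf⁺ Star? (inj₁ refl))
      (λ x∈S xy → ∈-subsetOf⁺ Star? (star-closed (∈-subsetOf⁻ Star? x∈S) xy))
      (star-reachable ∘ ∈-subsetOf⁻ Star?)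

    degree≡ : degree G a ≡ suc ∣ subsetOf Beyond? ∣
    degree≡ = ∣subsetOf∣-extend (Adj? G a) Beyond? ab (λ (_ , b≢b) → b≢b refl)
      λ y≢b → mk⇔ (_, y≢b) proj₁

    star≡ : ∣ subsetOf Star? ∣ ≡ suc ∣ subsetOf Beyond? ∣
    star≡ = ∣subsetOf∣-extend Star? Beyond? (inj₁ refl) (λ (aa , _) → Adj-irrefl G aa refl)
      λ y≢a → mk⇔ [ (λ y≡a → contradiction y≡a y≢a) , id ] inj₂

    beyond-nonempty : 1 ≤ ∣ subsetOf Beyond? ∣
    beyond-nonempty = ≤-trans (s≤s z≤n) (x∈p⇒∣p-x∣<∣p∣ (∈-subsetOf⁺ Beyond? (ac , c≢b)))

    size : ∣ subsetOf Star? ∣ ≡ 2 ⊎ ∣ subsetOf Star? ∣ ≡ 3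
    size rewrite star≡ = two-or-three beyond-nonempty (subst (_≤ 3) degree≡ deg≤3)

lemma2p3 : ∀ {n : ℕ} (G : Graph n) → IsTree G → (∀ x → degree G x ≤ 3) → 3 ≤ n →
    Σ (Fin n) λ u → Σ (Fin n) λ v → Adj G u v ×
      Σ (Subset n) λ S → IsComponentOf (deleteEdge G u v) u S × (∣ S ∣ ≡ 2 ⊎ ∣ S ∣ ≡ 3)
lemma2p3 G (connected , acyclic) deg≤3 3≤n =
  let a₀ , b₀ , a₀b₀ , other₀ = branchingEdge G connected 3≤n
      a , b , ab , other , leaves = pendantStarEdge G acyclic a₀b₀ other₀
  in a , b , ab , cutPendantStar G ab other leaves (deg≤3 a)
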